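{- Let $n\ge 0$ and $p\ge 0$ be integers with $2p^2+3p\le n\le 2p^2+7p+4$. Then $\operatorname{diam}(\mathcal{R}_n)\ge n-p$.
   Context: A binary string is run-constrained if every maximal run of 1s in it is immediately followed by a maximal run of 0s of strictly greater length. For $n\ge 0$, the Fibonacci-run graph $\mathcal{R}_n$ has as vertices all binary strings $r$ of length $n$ such that $r00$ (the string $r$ followed by two 0s) is run-constrained; two vertices are adjacent if they differ in exactly one coordinate (for $n=0$ it is the one-vertex graph on the empty string). $\operatorname{diam}(G)$ denotes the maximum graph distance between two vertices of the connected graph $G$. -}

module Defs where

open import Data.Bool using (Bool; true; false; if_then_else_)
open import Data.Bool.Properties using () renaming (_≟_ to _≟B_)
open import Data.Nat using (ℕ; zero; suc; _<_)
open import Data.Product using (Σ; ∃; _×_; _,_)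
open import Data.List using (List; []; _∷_; _++_)
open import Data.Vec using (Vec; toList; lookup)
open import Data.Fin using (Fin)
open import Relation.Nullary using (¬_; does)
open import Relation.Binary.PropositionalEquality using (_≡_; _≢_)

-- Binary strings: true = 1, false = 0.

pushRun : Bool → List (Bool × ℕ) → List (Bool × ℕ)
pushRun b [] = (b , 1) ∷ []
pushRun b ((c , k) ∷ rs) =
  if does (b ≟B c) then (c , suc k) ∷ rs else (b , 1) ∷ (c , k) ∷ rs

runs : List Bool → List (Bool × ℕ)
runs [] = []
runs (b ∷ xs) = pushRun b (runs xs)

data RunsOK : List (Bool × ℕ) → Set where
  ok-nil  : RunsOK []
  ok-zero : ∀ {k rs} → RunsOK rs → RunsOK ((false , k) ∷ rs)
  ok-one  : ∀ {k m rs} → k < m → RunsOK ((false , m) ∷ rs) →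
            RunsOK ((true , k) ∷ (false , m) ∷ rs)

RunConstrained : List Bool → Set
RunConstrained w = RunsOK (runs w)

-- Vertices of the Fibonacci-run graph R_n: strings r of length n with r00 run-constrained.
IsFR : (n : ℕ) → Vec Bool n → Set
IsFR n r = RunConstrained (toList r ++ false ∷ false ∷ [])

Vertex : ℕ → Set
Vertex n = Σ (Vec Bool n) (IsFR n)

Adj : {n : ℕ} → Vertex n → Vertex n → Set
Adj {n} (u , _) (v , _) =
  ∃ λ (i : Fin n) → (lookup u i ≢ lookup v i) × (∀ j → j ≢ i → lookup u j ≡ lookup v j)

data Walk {n : ℕ} : Vertex n → Vertex n → ℕ → Set where
  here : ∀ {u} → Walk u u 0
  step : ∀ {u w v k} → Adj u w → Walk w v k → Walk u v (suc k)

DistAtLeast : {n : ℕ} → Vertex n → Vertex n → ℕ → Set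
DistAtLeast u v d = ∀ k → Walk u v k → d Data.Nat.≤ k

DiamAtLeast : ℕ → ℕ → Set
DiamAtLeast n d = ∃ λ (u : Vertex n) → ∃ λ (v : Vertex n) → DistAtLeast u v d

-- An edge of R_n changes one coordinate, so graph distance is at least Hamming distance.
-- For N = 2p² + 7p + 4 the strings X = 0 1² 0³ ⋯ 1^(2p+2) 0^(2p+1) and
-- Y = 1 0² 1³ ⋯ 0^(2p+2) 1^(p+1) 0^p are vertices of R_N differing in all but their last
-- p positions. Deleting the first coordinate maps R_(m+1) to R_m, since the run constraint
-- is closed under suffixes, and lowers Hamming distance by at most one; so a pair at
-- Hamming distance at least m − p persists down to every n ≤ N.

{-# OPTIONS --safe #-}
module Submission where

open import Defs
open import Data.Nat using (ℕ; _+_; _*_; _∸_; _≤_)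
open import Data.Nat using (zero; suc; _<_; z≤n; s≤s; s≤s⁻¹; _≤′_; ≤′-refl; ≤′-step)
open import Data.Nat.Properties
  using (≤-refl; ≤-reflexive; ≤-trans; +-mono-≤; +-monoˡ-≤; +-monoʳ-≤; +-assoc; +-suc;
         +-identityʳ; n≤1+n; m≤n+o⇒m∸n≤o; ≤⇒≤′; module ≤-Reasoning; +-commutativeSemigroup)
open import Algebra.Properties.CommutativeSemigroup +-commutativeSemigroup using (interchange)
open import Data.Nat.Tactic.RingSolver using (solve)
open import Data.Bool using (Bool; true; false; not)
open import Data.List using (List; []; _∷_; [_]; _++_; replicate; length; zipWith)
open import Data.Nat.ListAction using (sum)
open import Data.List.Properties using (++-assoc; length-++; length-replicate)
open import Data.Vec using (Vec; []; _∷_; toList; fromList; lookup; cast)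
open import Data.Vec.Properties using (toList-cast; toList∘fromList)
open import Data.Vec.Relation.Binary.Pointwise.Extensional using (ext; Pointwise-≡⇒≡)
open import Data.Fin using (Fin; zero; suc)
import Data.Fin.Properties as Fin
open import Data.Product using (_×_; _,_; proj₁)
open import Function using (id; _∘_)
open import Relation.Binary.PropositionalEquality
  using (_≡_; _≢_; refl; sym; trans; cong; cong₂; subst; module ≡-Reasoning)

mismatch : Bool → Bool → ℕ
mismatch false false = 0
mismatch true  true  = 0
mismatch _     _     = 1

mismatch≤1 : ∀ x y → mismatch x y ≤ 1
mismatch≤1 false false = z≤n
mismatch≤1 false true  = ≤-refl
mismatch≤1 true  false = ≤-refl
mismatch≤1 true  true  = z≤n

mismatch-self : ∀ x → mismatch x x ≡ 0
mismatch-self false = refl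
mismatch-self true  = refl

mismatch-not : ∀ x → mismatch x (not x) ≡ 1
mismatch-not false = refl
mismatch-not true  = refl

mismatch-triangle : ∀ x y z → mismatch x z ≤ mismatch x y + mismatch y z
mismatch-triangle false false z = ≤-refl
mismatch-triangle true  true  z = ≤-refl
mismatch-triangle false true  z = ≤-trans (mismatch≤1 false z) (s≤s z≤n)
mismatch-triangle true  false z = ≤-trans (mismatch≤1 true z) (s≤s z≤n)

hamming : List Bool → List Bool → ℕ
hamming xs ys = sum (zipWith mismatch xs ys)

hamming-self : ∀ xs → hamming xs xs ≡ 0
hamming-self []       = refl
hamming-self (x ∷ xs) = cong₂ _+_ (mismatch-self x) (hamming-self xs)

hamming-replicate-not-++ : ∀ j c t t' →
  hamming (replicate j c ++ t) (replicate j (not c) ++ t') ≡ j + hamming t t'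
hamming-replicate-not-++ zero    c t t' = refl
hamming-replicate-not-++ (suc j) c t t' =
  cong₂ _+_ (mismatch-not c) (hamming-replicate-not-++ j c t t')

hammingᵛ : ∀ {n} → Vec Bool n → Vec Bool n → ℕ
hammingᵛ u v = hamming (toList u) (toList v)

hammingᵛ-triangle : ∀ {n} (u v w : Vec Bool n) → hammingᵛ u w ≤ hammingᵛ u v + hammingᵛ v w
hammingᵛ-triangle []      []      []      = z≤n
hammingᵛ-triangle (x ∷ u) (y ∷ v) (z ∷ w) = begin
  mismatch x z + hammingᵛ u w
    ≤⟨ +-mono-≤ (mismatch-triangle x y z) (hammingᵛ-triangle u v w) ⟩
  (mismatch x y + mismatch y z) + (hammingᵛ u v + hammingᵛ v w)
    ≡⟨ interchange (mismatch x y) (mismatch y z) (hammingᵛ u v) (hammingᵛ v w) ⟩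
  (mismatch x y + hammingᵛ u v) + (mismatch y z + hammingᵛ v w) ∎
  where open ≤-Reasoning

hammingᵛ-≤1 : ∀ {n} (u v : Vec Bool n) (i : Fin n) →
  (∀ j → j ≢ i → lookup u j ≡ lookup v j) → hammingᵛ u v ≤ 1
hammingᵛ-≤1 (x ∷ u) (y ∷ v) zero agree
  with refl ← Pointwise-≡⇒≡ {xs = u} {v} (ext λ j → agree (suc j) λ ())
  rewrite hamming-self (toList u) | +-identityʳ (mismatch x y) = mismatch≤1 x y
hammingᵛ-≤1 (x ∷ u) (y ∷ v) (suc i) agree
  rewrite agree zero (λ ()) | mismatch-self y =
  hammingᵛ-≤1 u v i (λ j j≢i → agree (suc j) (j≢i ∘ Fin.suc-injective))

hammingᵛ-≤-walk : ∀ {n} {u v : Vertex n} {k} → Walk u v k → hammingᵛ (proj₁ u) (proj₁ v) ≤ k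
hammingᵛ-≤-walk {u = u , _} here = ≤-reflexive (hamming-self (toList u))
hammingᵛ-≤-walk {u = u , _} {v , _} (step {w = w , _} (i , _ , agree) walk) =
  ≤-trans (hammingᵛ-triangle u w v) (+-mono-≤ (hammingᵛ-≤1 u w i agree) (hammingᵛ-≤-walk walk))

RunsOK-pushRun⁻ : ∀ b rs → RunsOK (pushRun b rs) → RunsOK rs
RunsOK-pushRun⁻ _     []                 _               = ok-nil
RunsOK-pushRun⁻ false ((false , _) ∷ _) (ok-zero ok)    = ok-zero ok
RunsOK-pushRun⁻ false ((true  , _) ∷ _) (ok-zero ok)    = ok
RunsOK-pushRun⁻ true  ((true  , _) ∷ _) (ok-one k<m ok) = ok-one (≤-trans (n≤1+n _) k<m) ok
RunsOK-pushRun⁻ true  ((false , _) ∷ _) (ok-one _ ok)   = ok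

RunConstrained₀₀ : List Bool → Set
RunConstrained₀₀ r = RunConstrained (r ++ false ∷ false ∷ [])

record FarPair (n p : ℕ) : Set where
  constructor farPair
  field
    u v : Vertex n
    far : n ≤ p + hammingᵛ (proj₁ u) (proj₁ v)

FarPair⇒DiamAtLeast : ∀ {n p} → FarPair n p → DiamAtLeast n (n ∸ p)
FarPair⇒DiamAtLeast {p = p} (farPair u v far) =
  u , v , λ k walk → ≤-trans (m≤n+o⇒m∸n≤o _ p far) (hammingᵛ-≤-walk walk)

FarPair-tail : ∀ {n p} → FarPair (suc n) p → FarPair n p
FarPair-tail {p = p} (farPair (x ∷ u , rcu) (y ∷ v , rcv) far) =
  farPair (u , RunsOK-pushRun⁻ x _ rcu) (v , RunsOK-pushRun⁻ y _ rcv) (s≤s⁻¹ (begin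
    suc _
      ≤⟨ far ⟩
    p + (mismatch x y + hammingᵛ u v)
      ≤⟨ +-monoʳ-≤ p (+-monoˡ-≤ (hammingᵛ u v) (mismatch≤1 x y)) ⟩
    p + suc (hammingᵛ u v)
      ≡⟨ +-suc p (hammingᵛ u v) ⟩
    suc (p + hammingᵛ u v) ∎))
  where open ≤-Reasoning

FarPair-shrink : ∀ {n N p} → n ≤′ N → FarPair N p → FarPair n p
FarPair-shrink ≤′-refl         = id
FarPair-shrink (≤′-step n≤′N) = FarPair-shrink n≤′N ∘ FarPair-tail

toList-cast-fromList : ∀ {n} (xs : List Bool) .(eq : length xs ≡ n) →
  toList (cast eq (fromList xs)) ≡ xs
toList-cast-fromList xs eq = trans (toList-cast eq (fromList xs)) (toList∘fromList xs)

FarPair-fromLists : ∀ {n p} (xs ys : List Bool) (∣xs∣ : length xs ≡ n) (∣ys∣ : length ys ≡ n) →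
  RunConstrained₀₀ xs → RunConstrained₀₀ ys → n ≤ p + hamming xs ys → FarPair n p
FarPair-fromLists {n} {p} xs ys ∣xs∣ ∣ys∣ rcx rcy far =
  farPair (cast ∣xs∣ (fromList xs) , subst RunConstrained₀₀ (sym xs≡) rcx)
          (cast ∣ys∣ (fromList ys) , subst RunConstrained₀₀ (sym ys≡) rcy)
          (subst (λ h → n ≤ p + h) (sym (cong₂ hamming xs≡ ys≡)) far)
  where
  xs≡ : toList (cast ∣xs∣ (fromList xs)) ≡ xs
  xs≡ = toList-cast-fromList xs ∣xs∣
  ys≡ : toList (cast ∣ys∣ (fromList ys)) ≡ ys
  ys≡ = toList-cast-fromList ys ∣ys∣

triangular : ℕ → ℕ
triangular zero    = 0
triangular (suc k) = triangular k + suc k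

triangular-even : ∀ p → triangular (suc (suc (p + p))) ≡ 2 * p * p + 5 * p + 3
triangular-even zero = refl
triangular-even (suc p) rewrite +-suc p p | triangular-even p = solve [ p ]

-- The maximal runs of staircase c k t are, from the left, of lengths 1, 2, …, k,
-- alternating in symbol and ending with c^k; then t follows.
staircase : Bool → ℕ → List Bool → List Bool
staircase c zero    t = t
staircase c (suc k) t = staircase (not c) k (replicate (suc k) c ++ t)

staircase-++ : ∀ c k t s → staircase c k t ++ s ≡ staircase c k (t ++ s)
staircase-++ c zero    t s = refl
staircase-++ c (suc k) t s =
  trans (staircase-++ (not c) k _ s)
        (cong (staircase (not c) k) (++-assoc (replicate (suc k) c) t s))

length-staircase : ∀ c k t → length (staircase c k t) ≡ triangular k + length t
length-staircase c zero    t = refl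
length-staircase c (suc k) t = begin
  length (staircase (not c) k (replicate (suc k) c ++ t))
    ≡⟨ length-staircase (not c) k _ ⟩
  triangular k + length (replicate (suc k) c ++ t)
    ≡⟨ cong (triangular k +_) (length-++ (replicate (suc k) c)) ⟩
  triangular k + (length (replicate (suc k) c) + length t)
    ≡⟨ cong (λ l → triangular k + (l + length t)) (length-replicate (suc k)) ⟩
  triangular k + (suc k + length t)
    ≡⟨ sym (+-assoc (triangular k) (suc k) (length t)) ⟩
  triangular k + suc k + length t ∎
  where open ≡-Reasoning

hamming-staircase : ∀ c k t t' →
  hamming (staircase c k t) (staircase (not c) k t') ≡ triangular k + hamming t t'
hamming-staircase c zero    t t' = refl
hamming-staircase c (suc k) t t' = begin
  hamming (staircase (not c) k (replicate (suc k) c ++ t))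
          (staircase (not (not c)) k (replicate (suc k) (not c) ++ t'))
    ≡⟨ hamming-staircase (not c) k _ _ ⟩
  triangular k + hamming (replicate (suc k) c ++ t) (replicate (suc k) (not c) ++ t')
    ≡⟨ cong (triangular k +_) (hamming-replicate-not-++ (suc k) c t t') ⟩
  triangular k + (suc k + hamming t t')
    ≡⟨ sym (+-assoc (triangular k) (suc k) (hamming t t')) ⟩
  triangular k + suc k + hamming t t' ∎
  where open ≡-Reasoning

runs-replicate-++-same : ∀ k c t {L rs} → runs t ≡ (c , L) ∷ rs →
  runs (replicate k c ++ t) ≡ (c , k + L) ∷ rs
runs-replicate-++-same zero    c     t eq = eq
runs-replicate-++-same (suc k) false t eq rewrite runs-replicate-++-same k false t eq = refl
runs-replicate-++-same (suc k) true  t eq rewrite runs-replicate-++-same k true  t eq = refl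

runs-replicate-++-new : ∀ k c t {L rs} → runs t ≡ (not c , L) ∷ rs →
  runs (replicate (suc k) c ++ t) ≡ (c , suc k) ∷ (not c , L) ∷ rs
runs-replicate-++-new zero    false t eq rewrite eq = refl
runs-replicate-++-new zero    true  t eq rewrite eq = refl
runs-replicate-++-new (suc k) false t eq rewrite runs-replicate-++-new k false t eq = refl
runs-replicate-++-new (suc k) true  t eq rewrite runs-replicate-++-new k true  t eq = refl

record Prependable (c : Bool) (k : ℕ) (t : List Bool) : Set where
  constructor prependable
  field
    len         : ℕ
    rest        : List (Bool × ℕ)
    runs-t      : runs t ≡ (not c , len) ∷ rest
    constrained : RunConstrained t
    longer      : c ≡ true → k < len

Prependable-replicate-++ : ∀ c k t → Prependable c (suc k) t →
  Prependable (not c) k (replicate (suc k) c ++ t)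
Prependable-replicate-++ true k t (prependable L rs eq rc longer) =
  prependable (suc k) _ new (subst RunsOK (sym new) (ok-one (longer refl) (subst RunsOK eq rc))) λ ()
  where
  new : runs (replicate (suc k) true ++ t) ≡ (true , suc k) ∷ (false , L) ∷ rs
  new = runs-replicate-++-new k true t eq
Prependable-replicate-++ false k t (prependable L rs eq rc longer) =
  prependable (suc k) _ new (subst RunsOK (sym new) (ok-zero (subst RunsOK eq rc))) λ _ → ≤-refl
  where
  new : runs (replicate (suc k) false ++ t) ≡ (false , suc k) ∷ (true , L) ∷ rs
  new = runs-replicate-++-new k false t eq

staircase-runConstrained : ∀ c k t → Prependable c k t → RunConstrained (staircase c k t)
staircase-runConstrained c zero    t pre = Prependable.constrained pre
staircase-runConstrained c (suc k) t pre =
  staircase-runConstrained (not c) k _ (Prependable-replicate-++ c k t pre)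

module StaircasePair (p : ℕ) where

  height : ℕ
  height = suc (suc (p + p))

  ending : Bool → List Bool
  ending c = replicate (suc p) c ++ replicate p false

  X Y : List Bool
  X = staircase true  height (ending false)
  Y = staircase false height (ending true)

  length-staircase-ending : ∀ c d →
    length (staircase c height (ending d)) ≡ 2 * p * p + 7 * p + 4
  length-staircase-ending c d = begin
    length (staircase c height (ending d))
      ≡⟨ length-staircase c height (ending d) ⟩
    triangular height + length (ending d)
      ≡⟨ cong (triangular height +_) (length-++ (replicate (suc p) d)) ⟩
    triangular height + (length (replicate (suc p) d) + length (replicate p false))
      ≡⟨ cong₂ (λ a b → triangular height + (a + b)) (length-replicate (suc p)) (length-replicate p) ⟩
    triangular height + (suc p + p)
      ≡⟨ cong (_+ (suc p + p)) (triangular-even p) ⟩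
    2 * p * p + 5 * p + 3 + (suc p + p)
      ≡⟨ solve [ p ] ⟩
    2 * p * p + 7 * p + 4 ∎
    where open ≡-Reasoning

  X-far-from-Y : 2 * p * p + 7 * p + 4 ≤ p + hamming X Y
  X-far-from-Y = ≤-reflexive (sym (begin
    p + hamming X Y
      ≡⟨ cong (p +_) (hamming-staircase true height (ending false) (ending true)) ⟩
    p + (triangular height + hamming (ending false) (ending true))
      ≡⟨ cong (λ h → p + (triangular height + h)) (hamming-replicate-not-++ (suc p) false _ _) ⟩
    p + (triangular height + (suc p + hamming (replicate p false) (replicate p false)))
      ≡⟨ cong₂ (λ t h → p + (t + (suc p + h))) (triangular-even p) (hamming-self (replicate p false)) ⟩
    p + (2 * p * p + 5 * p + 3 + (suc p + 0))
      ≡⟨ solve [ p ] ⟩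
    2 * p * p + 7 * p + 4 ∎))
    where open ≡-Reasoning

  runs-ending-false : runs (ending false ++ false ∷ false ∷ []) ≡ (false , suc p + (p + 2)) ∷ []
  runs-ending-false =
    trans (cong runs (++-assoc (replicate (suc p) false) (replicate p false) _))
          (runs-replicate-++-same (suc p) false _ (runs-replicate-++-same p false _ refl))

  runs-ending-true : runs (ending true ++ false ∷ false ∷ []) ≡ (true , suc p) ∷ (false , p + 2) ∷ []
  runs-ending-true =
    trans (cong runs (++-assoc (replicate (suc p) true) (replicate p false) _))
          (runs-replicate-++-new p true _ (runs-replicate-++-same p false _ refl))

  X-constrained : RunConstrained₀₀ X
  X-constrained = subst RunConstrained (sym (staircase-++ true height (ending false) _))
    (staircase-runConstrained true height _
      (prependable _ [] runs-ending-false
        (subst RunsOK (sym runs-ending-false) (ok-zero ok-nil))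
        (λ _ → ≤-reflexive {3 + (p + p)} (solve [ p ]))))

  Y-constrained : RunConstrained₀₀ Y
  Y-constrained = subst RunConstrained (sym (staircase-++ false height (ending true) _))
    (staircase-runConstrained false height _
      (prependable _ _ runs-ending-true
        (subst RunsOK (sym runs-ending-true) (ok-one (≤-reflexive (solve [ p ])) (ok-zero ok-nil)))
        λ ()))

  farPair-X-Y : FarPair (2 * p * p + 7 * p + 4) p
  farPair-X-Y = FarPair-fromLists X Y (length-staircase-ending true false)
    (length-staircase-ending false true) X-constrained Y-constrained X-far-from-Y

lemma3p6 : (n p : ℕ) → 2 * p * p + 3 * p ≤ n → n ≤ 2 * p * p + 7 * p + 4 →
    DiamAtLeast n (n ∸ p)
lemma3p6 n p _ n≤N =
  FarPair⇒DiamAtLeast (FarPair-shrink (≤⇒≤′ n≤N) (StaircasePair.farPair-X-Y p))
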